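{- Let $G_1,\dots,G_n$ be groups ($n\ge 2$) and let $G\le G_1\times\dots\times G_n$ be a subgroup such that each projection $\pi_i:G\to G_i$ is surjective. For $j\in\{1,\dots,n\}$ let $S_j=\{1,\dots,n\}\setminus\{j\}$ and let $Q_j=G_j/\pi_j\big(G\cap(G_j\times\{1\})\big)$ be the Goursat quotient of $G$ viewed as a subgroup of $G_j\times G_{S_j}$. Then $G$ has abelian entanglements with respect to $G_1\times\dots\times G_n$ if and only if $Q_j$ is abelian for every $j\in\{1,\dots,n\}$.
   Context: For nonempty $S\subseteq\{1,\dots,n\}$, $\pi_S$ denotes the projection onto $\prod_{i\in S}G_i$ and $G_S=\pi_S(G)$; $G\le G_S\times G_T$ for a partition $\{S,T\}$. The Goursat quotient for a two-set partition $\{S,T\}$ (both nonempty) is $G_S/\pi_S(G\cap(G_S\times\{1\}))$. $G$ has abelian entanglements with respect to $G_1\times\dots\times G_n$ if the Goursat quotient is abelian for every two-set partition $\{S,T\}$ of $\{1,\dots,n\}$ into nonempty sets. -}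

module Defs where

open import Level using (_⊔_)
open import Data.Nat using (ℕ)
open import Data.Fin using (Fin)
open import Data.Fin.Subset using (Subset; _∈_; _∉_)
open import Data.Product using (Σ; ∃; _×_; _,_)
open import Relation.Nullary using (¬_)
open import Relation.Binary.PropositionalEquality using (_≡_)
open import Algebra.Bundles using (Group)

module _ {c ℓ : _} {n : ℕ} (G : Fin n → Group c ℓ) where

  open Group using (Carrier)

  Prod : Set c
  Prod = (i : Fin n) → Carrier (G i)

  _≈ₚ_ : Prod → Prod → Set ℓ
  x ≈ₚ y = ∀ i → Group._≈_ (G i) (x i) (y i)

  _∙ₚ_ : Prod → Prod → Prod
  (x ∙ₚ y) i = Group._∙_ (G i) (x i) (y i)

  εₚ : Prod
  εₚ i = Group.ε (G i)

  _⁻¹ₚ : Prod → Prod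
  (x ⁻¹ₚ) i = Group._⁻¹ (G i) (x i)

  record IsSubgroup {p : _} (H : Prod → Set p) : Set (c ⊔ ℓ ⊔ p) where
    field
      resp  : ∀ {x y} → x ≈ₚ y → H x → H y
      ε-mem : H εₚ
      ∙-mem : ∀ {x y} → H x → H y → H (x ∙ₚ y)
      ⁻¹-mem : ∀ {x} → H x → H (x ⁻¹ₚ)

  ProjectionsSurjective : {p : _} → (Prod → Set p) → Set (c ⊔ ℓ ⊔ p)
  ProjectionsSurjective H =
    ∀ (i : Fin n) (a : Carrier (G i)) → Σ Prod λ g → H g × Group._≈_ (G i) (g i) a

  ProdOn : Subset n → Set c
  ProdOn S = (i : Fin n) → i ∈ S → Carrier (G i)

  _≈ₛ_ : {S : Subset n} → ProdOn S → ProdOn S → Set ℓ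
  x ≈ₛ y = ∀ i p → Group._≈_ (G i) (x i p) (y i p)

  _∙ₛ_ : {S : Subset n} → ProdOn S → ProdOn S → ProdOn S
  (x ∙ₛ y) i p = Group._∙_ (G i) (x i p) (y i p)

  _⁻¹ₛ : {S : Subset n} → ProdOn S → ProdOn S
  (x ⁻¹ₛ) i p = Group._⁻¹ (G i) (x i p)

  π : (S : Subset n) → Prod → ProdOn S
  π S g i _ = g i

  module _ {p : _} (H : Prod → Set p) (S : Subset n) where

    InProj : ProdOn S → Set (c ⊔ ℓ ⊔ p)
    InProj x = Σ Prod λ g → H g × (x ≈ₛ π S g)

    InKernel : ProdOn S → Set (c ⊔ ℓ ⊔ p)
    InKernel x = Σ Prod λ g → H g
                   × (∀ i → i ∉ S → Group._≈_ (G i) (g i) (Group.ε (G i)))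
                   × (x ≈ₛ π S g)

    QuotRel : ProdOn S → ProdOn S → Set (c ⊔ ℓ ⊔ p)
    QuotRel x y = InKernel (x ∙ₛ (y ⁻¹ₛ))

    GoursatQuotientAbelian : Set (c ⊔ ℓ ⊔ p)
    GoursatQuotientAbelian =
      ∀ x y → InProj x → InProj y → QuotRel (x ∙ₛ y) (y ∙ₛ x)

  AbelianEntanglements : {p : _} → (Prod → Set p) → Set (c ⊔ ℓ ⊔ p)
  AbelianEntanglements H =
    ∀ (S : Subset n) → (∃ λ i → i ∈ S) → (∃ λ i → i ∉ S) → GoursatQuotientAbelian H S

  module _ {p : _} (H : Prod → Set p) (j : Fin n) where

    InKernelⱼ : Carrier (G j) → Set (c ⊔ ℓ ⊔ p)
    InKernelⱼ a = Σ Prod λ g → H g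
                    × (∀ i → ¬ (i ≡ j) → Group._≈_ (G i) (g i) (Group.ε (G i)))
                    × Group._≈_ (G j) a (g j)

    QuotRelⱼ : Carrier (G j) → Carrier (G j) → Set (c ⊔ ℓ ⊔ p)
    QuotRelⱼ a b = InKernelⱼ (Group._∙_ (G j) a (Group._⁻¹ (G j) b))

    QAbelian : Set (c ⊔ ℓ ⊔ p)
    QAbelian = ∀ (a b : Carrier (G j)) →
      QuotRelⱼ (Group._∙_ (G j) a b) (Group._∙_ (G j) b a)

module Submission where

-- For a coordinate j the
-- quotient Q_j is the Goursat quotient for the partition {{j}, rest}, so one
-- direction is immediate: abelian entanglements give Q_j abelian for every j
-- (n ≥ 2 makes {j} a proper nonempty subset; surjectivity lifts elements of G_j).
--
-- For the converse, take a subset S and x, y ∈ G_S coming from g, h ∈ H. Each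
-- Q_i abelian gives an element k⁽ⁱ⁾ ∈ H supported on the single coordinate i
-- whose i-th entry is the commutator-type element (gᵢhᵢ)(hᵢgᵢ)⁻¹. The product
-- of the k⁽ⁱ⁾ over the (duplicate-free) list of coordinates in S lies in H,
-- is trivial outside S and agrees with (xy)(yx)⁻¹ on S, which is exactly what
-- the Goursat quotient of S being abelian asks for.

open import Level using (_⊔_)
open import Defs
open import Data.Nat using (ℕ; _≤_; s≤s; z≤n)
open import Data.Fin using (Fin) renaming (zero to fzero; suc to fsuc)
open import Data.Fin.Subset using (Subset; _∈_; _∉_; ⁅_⁆)
open import Data.Fin.Subset.Properties using (_∈?_; x∈⁅x⁆; x∈⁅y⁆⇒x≡y)
open import Data.List using (List; []; _∷_; filter; allFin)
open import Data.List.Relation.Unary.Any using (here; there)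
open import Data.List.Relation.Unary.All as All using ()
open import Data.List.Relation.Unary.AllPairs using (_∷_)
open import Data.List.Relation.Unary.Unique.Propositional using (Unique)
open import Data.List.Relation.Unary.Unique.Propositional.Properties using (allFin⁺; filter⁺)
open import Data.List.Membership.Propositional using () renaming (_∈_ to _∈ₗ_; _∉_ to _∉ₗ_)
open import Data.List.Membership.Propositional.Properties using (∈-allFin; ∈-filter⁺; ∈-filter⁻)
open import Data.Product using (Σ; ∃; _×_; _,_; proj₁; proj₂)
open import Relation.Nullary using (¬_)
open import Relation.Binary.PropositionalEquality using (_≡_; refl; sym)
open import Function using (_∘_)
open import Function.Bundles using (_⇔_; mk⇔)
open import Algebra.Bundles using (Group)

module _ {c ℓ} (K : Group c ℓ) where
  open Group K

  commutator-cong : ∀ {a a′ b b′} → a ≈ a′ → b ≈ b′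
                  → (a ∙ b) ∙ (b ∙ a) ⁻¹ ≈ (a′ ∙ b′) ∙ (b′ ∙ a′) ⁻¹
  commutator-cong a≈a′ b≈b′ =
    ∙-cong (∙-cong a≈a′ b≈b′) (⁻¹-cong (∙-cong b≈b′ a≈a′))

module _ {c ℓ p} {n : ℕ} (G : Fin n → Group c ℓ)
         (H : Prod G → Set p) (sub : IsSubgroup G H) where

  open IsSubgroup sub
  module Gᵢ (i : Fin n) = Group (G i)

  SupportedAt : Fin n → Prod G → Set ℓ
  SupportedAt i g = ∀ t → ¬ t ≡ i → Gᵢ._≈_ t (g t) (Gᵢ.ε t)

  SingleCoordinateFamily : (Fin n → Prod G) → Set (ℓ ⊔ p)
  SingleCoordinateFamily f = ∀ i → H (f i) × SupportedAt i (f i)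

  module Assembly (f : Fin n → Prod G) (family : SingleCoordinateFamily f) where

    product : List (Fin n) → Prod G
    product []       = εₚ G
    product (i ∷ is) = _∙ₚ_ G (f i) (product is)

    product-mem : ∀ is → H (product is)
    product-mem []       = ε-mem
    product-mem (i ∷ is) = ∙-mem (proj₁ (family i)) (product-mem is)

    product-outside : ∀ {t} is → t ∉ₗ is → Gᵢ._≈_ t (product is t) (Gᵢ.ε t)
    product-outside {t} []       _   = Gᵢ.refl t
    product-outside {t} (i ∷ is) t∉ =
      Gᵢ.trans t (Gᵢ.∙-cong t (proj₂ (family i) t (t∉ ∘ here))
                              (product-outside is (t∉ ∘ there)))
                 (Gᵢ.identityˡ t (Gᵢ.ε t))

    product-inside : ∀ {t} is → Unique is → t ∈ₗ is
                   → Gᵢ._≈_ t (product is t) (f t t)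
    product-inside {t} (t ∷ is) (distinct ∷ _) (here refl) =
      Gᵢ.trans t (Gᵢ.∙-cong t (Gᵢ.refl t)
                              (product-outside is (λ t∈is → All.lookup distinct t∈is refl)))
                 (Gᵢ.identityʳ t (f t t))
    product-inside {t} (i ∷ is) (distinct ∷ unique) (there t∈is) =
      Gᵢ.trans t (Gᵢ.∙-cong t (proj₂ (family i) t (λ t≡i → All.lookup distinct t∈is (sym t≡i)))
                              (product-inside is unique t∈is))
                 (Gᵢ.identityˡ t (f t t))

    assemble : (S : Subset n) → Σ (Prod G) λ k → H k
             × (∀ t → t ∈ S → Gᵢ._≈_ t (k t) (f t t))
             × (∀ t → t ∉ S → Gᵢ._≈_ t (k t) (Gᵢ.ε t))
    assemble S = product coords , product-mem coords , inside , outside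
      where
      coords : List (Fin n)
      coords = filter (_∈? S) (allFin n)

      inside : ∀ t → t ∈ S → Gᵢ._≈_ t (product coords t) (f t t)
      inside t t∈S = product-inside coords (filter⁺ (_∈? S) (allFin⁺ n))
                                    (∈-filter⁺ (_∈? S) (∈-allFin t) t∈S)

      outside : ∀ t → t ∉ S → Gᵢ._≈_ t (product coords t) (Gᵢ.ε t)
      outside t t∉S = product-outside coords
                        (t∉S ∘ proj₂ ∘ ∈-filter⁻ (_∈? S) {xs = allFin n})

  module _ (QA : ∀ j → QAbelian G H j) (g h : Prod G) where

    commutator-witness : Fin n → Prod G
    commutator-witness i = proj₁ (QA i (g i) (h i))

    commutator-witness-family : SingleCoordinateFamily commutator-witness
    commutator-witness-family i =
      let (_ , w∈H , w-supported , _) = QA i (g i) (h i) in w∈H , w-supported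

    commutator-witness-value : ∀ i → Gᵢ._≈_ i (Gᵢ._∙_ i (Gᵢ._∙_ i (g i) (h i))
                                                        (Gᵢ._⁻¹ i (Gᵢ._∙_ i (h i) (g i))))
                                              (commutator-witness i i)
    commutator-witness-value i = proj₂ (proj₂ (proj₂ (QA i (g i) (h i))))

  -- If every Q_j is abelian then the Goursat quotient of every subset S is
  -- abelian (no nonemptiness of S or its complement is needed): assemble the
  -- commutator witnesses of the coordinates in S.
  abelian-goursat : (∀ j → QAbelian G H j) → ∀ S → GoursatQuotientAbelian G H S
  abelian-goursat QA S x y (g , _ , x≈g) (h , _ , y≈h) =
    let (k , k∈H , k-inside , k-outside) =
          Assembly.assemble (commutator-witness QA g h)
                            (commutator-witness-family QA g h) S
    in k , k∈H , k-outside , λ t t∈S →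
         Gᵢ.trans t (commutator-cong (G t) (x≈g t t∈S) (y≈h t t∈S))
                    (Gᵢ.trans t (commutator-witness-value QA g h t)
                                (Gᵢ.sym t (k-inside t t∈S)))

  -- Q_j is the Goursat quotient of the singleton {j}; surjectivity of π_j
  -- lifts any a, b ∈ G_j to elements of H, i.e. to elements of G_{j}.
  singleton-abelian : ProjectionsSurjective G H → ∀ j
                    → GoursatQuotientAbelian G H ⁅ j ⁆ → QAbelian G H j
  singleton-abelian surj j GQA a b
    with surj j a | surj j b
  ... | g , g∈H , ga | h , h∈H , hb
    with GQA (π G ⁅ j ⁆ g) (π G ⁅ j ⁆ h)
             (g , g∈H , λ _ _ → Gᵢ.refl _) (h , h∈H , λ _ _ → Gᵢ.refl _)
  ... | k , k∈H , k-outside , k-eq =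
    k , k∈H , (λ i i≢j → k-outside i (i≢j ∘ x∈⁅y⁆⇒x≡y j)) ,
    Gᵢ.trans j (commutator-cong (G j) (Gᵢ.sym j ga) (Gᵢ.sym j hb))
               (k-eq j (x∈⁅x⁆ j))

another-index : ∀ {n} → 2 ≤ n → (j : Fin n) → ∃ λ i → ¬ i ≡ j
another-index (s≤s (s≤s z≤n)) fzero    = fsuc fzero , λ ()
another-index (s≤s (s≤s z≤n)) (fsuc _) = fzero , λ ()

corollary2p5 : ∀ {c ℓ p} (n : ℕ) → 2 ≤ n → (G : Fin n → Group c ℓ)
    → (H : Prod G → Set p) → IsSubgroup G H → ProjectionsSurjective G H
    → AbelianEntanglements G H ⇔ (∀ (j : Fin n) → QAbelian G H j)
corollary2p5 n 2≤n G H sub surj = mk⇔ forward backward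
  where
  forward : AbelianEntanglements G H → ∀ j → QAbelian G H j
  forward AE j =
    let (i , i≢j) = another-index 2≤n j
    in singleton-abelian G H sub surj j
         (AE ⁅ j ⁆ (j , x∈⁅x⁆ j) (i , i≢j ∘ x∈⁅y⁆⇒x≡y j))

  backward : (∀ j → QAbelian G H j) → AbelianEntanglements G H
  backward QA S _ _ = abelian-goursat G H sub QA S
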